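{- Let $d\geq 2$ and $k\ge 0$ be integers and let $\underline{e}=(e_1,\ldots,e_{d-2})$ be a tuple of $2$-element subsets of $\mathbb{N}$ with $e_1\cup\cdots\cup e_{d-2}=[k]$. For each $n'\geq k$, with $E'=\binom{[n']}{2}$, let $\gamma(n')\in\mathbb{Z}_{\ge0}^{E'}$ be the vector with $\gamma(n')_e=|\{i: e_i=e\}|$, and let $A^{(n')}=Q_{\gamma(n')}\in\mathbb{R}^{E'\times E'}$ be defined below. Writing $a_{(e,f)}$ for the $(e,f)$-entry of $A^{(k+4)}$, we have $$a_{(\{k+1,k+2\},\{k+1,k+2\})}-2a_{(\{k+1,k+2\},\{k+1,k+3\})}+a_{(\{k+1,k+2\},\{k+3,k+4\})}\geq 0.$$
   Context: For $n'\ge 2$, $E'=\binom{[n']}{2}$, and $\alpha\in\mathbb{Z}_{\ge 0}^{E'}$ with $\sum_e\alpha_e=d$, define $$b_\alpha=\sum_{\substack{(f_1,\ldots,f_d)\in E'^d\\ \alpha(f_1,\dots,f_d)=\alpha}}\ \prod_{i=1}^d\frac{1}{|f_1\cup\cdots\cup f_i|},$$ where $\alpha(f_1,\dots,f_d)_e$ is the number of indices $i$ with $f_i=e$. For $\gamma\in\mathbb{Z}_{\ge0}^{E'}$ with $\sum_e\gamma_e=d-2$, let $v_e$ denote the standard basis vector of $\mathbb{R}^{E'}$ and define $Q_\gamma\in\mathbb{R}^{E'\times E'}$ by $(Q_\gamma)_{i,j}=(\gamma_i+1)(\gamma_j+1)\,b_{\gamma+v_i+v_j}$ if $i\neq j$,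 and $(Q_\gamma)_{i,i}=(\gamma_i+1)(\gamma_i+2)\,b_{\gamma+2v_i}$. These $Q_\gamma$ are the coefficient matrices of the Hessian of $f_d(x)=\sum_{(f_1,\ldots,f_d)\in E'^d}\prod_{i=1}^d \frac{x_{f_i}}{|f_1\cup\cdots\cup f_i|}$ in the monomial basis: $H(f_d)(x)=\sum_\gamma x^\gamma Q_\gamma$. -}

module Defs where

open import Data.Nat as ℕ using (ℕ; zero; suc; _<_; _≤_)
open import Data.Nat.Properties using (_≟_)
open import Data.Integer using (+_)
open import Data.Rational using (ℚ; _/_; _*_; _+_; 0ℚ; 1ℚ)
open import Data.Product using (_×_; _,_; proj₁; proj₂)
open import Data.Product.Properties using (≡-dec)
open import Data.List using (List; []; _∷_; length; map; concatMap; foldr; filterᵇ)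
open import Data.Empty using (⊥)
open import Data.Sum using (_⊎_)
open import Data.List.Relation.Unary.All using (All)
open import Data.Bool using (Bool; true; false; if_then_else_)
open import Relation.Nullary.Decidable using (does; Dec)
open import Relation.Binary.PropositionalEquality using (_≡_)
import Data.List.Membership.DecPropositional as DecMem

-- A 2-element subset {a,b} of ℕ is represented by the ordered pair (a , b) with a < b.
Edge : Set
Edge = ℕ × ℕ

IsEdge : Edge → Set
IsEdge (a , b) = a < b

_≟E_ : (e f : Edge) → Dec (e ≡ f)
_≟E_ = ≡-dec _≟_ _≟_

_==E_ : Edge → Edge → Bool
e ==E f = does (e ≟E f)

range : ℕ → ℕ → List ℕ
range s zero = []
range s (suc c) = s ∷ range (suc s) c

-- E' = binom([n],2) : all pairs (i , j) with 1 ≤ i < j ≤ n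
edges : ℕ → List Edge
edges n = concatMap (λ i → map (λ j → (i , j)) (range (suc i) (n ℕ.∸ i))) (range 1 n)

seqs : {A : Set} → List A → ℕ → List (List A)
seqs xs zero = [] ∷ []
seqs xs (suc d) = concatMap (λ x → map (x ∷_) (seqs xs d)) xs

-- 1/m as a rational (m = 0 never occurs below; it is mapped to 0 by convention)
inv : ℕ → ℚ
inv zero = 0ℚ
inv (suc m) = + 1 / suc m

open DecMem _≟_ using (_∈?_)

insertV : ℕ → List ℕ → List ℕ
insertV x vs = if does (x ∈? vs) then vs else x ∷ vs

-- weightFrom vs (f_1,…,f_r) = ∏_i 1 / |vs ∪ f_1 ∪ ⋯ ∪ f_i|
weightFrom : List ℕ → List Edge → ℚ
weightFrom vs [] = 1ℚ
weightFrom vs ((a , b) ∷ fs) =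
  let vs' = insertV b (insertV a vs) in inv (length vs') * weightFrom vs' fs

weight : List Edge → ℚ
weight = weightFrom []

multiplicity : List Edge → Edge → ℕ
multiplicity fs e = length (filterᵇ (λ f → f ==E e) fs)

sumℚ : List ℚ → ℚ
sumℚ = foldr _+_ 0ℚ

allᵇ : {A : Set} → (A → Bool) → List A → Bool
allᵇ p = foldr (λ x r → if p x then r else false) true

matches : ℕ → (Edge → ℕ) → List Edge → Bool
matches n α fs = allᵇ (λ e → does (multiplicity fs e ≟ α e)) (edges n)

b : (n d : ℕ) → (Edge → ℕ) → ℚ
b n d α = sumℚ (map weight (filterᵇ (matches n α) (seqs (edges n) d)))

v : Edge → Edge → ℕ
v e f = if e ==E f then 1 else 0

_⊕_ : (Edge → ℕ) → (Edge → ℕ) → (Edge → ℕ)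
(α ⊕ β) e = α e ℕ.+ β e

ℕtoℚ : ℕ → ℚ
ℕtoℚ m = + m / 1

Q : (n d : ℕ) → (Edge → ℕ) → Edge → Edge → ℚ
Q n d γ i j =
  if i ==E j
  then ℕtoℚ ((γ i ℕ.+ 1) ℕ.* (γ i ℕ.+ 2)) * b n d (γ ⊕ (v i ⊕ v i))
  else ℕtoℚ ((γ i ℕ.+ 1) ℕ.* (γ j ℕ.+ 1)) * b n d (γ ⊕ (v i ⊕ v j))

gammaOf : List Edge → Edge → ℕ
gammaOf es e = multiplicity es e

InUnion : ℕ → List Edge → Set
InUnion x [] = ⊥
InUnion x ((a , c) ∷ es) = (x ≡ a) ⊎ ((x ≡ c) ⊎ InUnion x es)

module Submission where

-- A sequence counted by b(γ + v_e + v_f), for edges e, f on the fresh vertices k+1, …, k+4, is a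
-- sequence realising γ, all of whose edges lie in [k], with e and f inserted. The fresh vertices are
-- disjoint from [k], so the vertex count after each step is that of the γ-part plus the number of
-- fresh vertices placed so far: 2 after the first of e, f and 2 + c after the second, where
-- c = 0, 1, 2 for the entries (e₁₂,e₁₂), (e₁₂,e₁₃), (e₁₂,e₃₄). With the factor (γ_e+1)(γ_e+2) = 2
-- on the diagonal and the two equal orders of e, f off it, the three entries are 2Ψ(0), 2Ψ(1),
-- 2Ψ(2) for a single Ψ. Expanding step by step, Ψ(c) is a sum of products of factors 1/(N + c)
-- with N ≥ 1 and factors independent of c; these are nonnegative, decreasing and convex in c, a
-- property closed under sums and products, so Ψ(0) − 2Ψ(1) + Ψ(2) ≥ 0.

open import Defs
open import Data.Bool using (Bool; true; false; if_then_else_; _∨_)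
open import Data.Bool.Properties using (T?; ∨-zeroʳ)
open import Data.Empty using (⊥-elim)
open import Data.Integer using (+_)
import Data.Integer.Solver as ℤSolver
open import Data.List using (List; []; _∷_; _++_; _∷ʳ_; length; map; concatMap; filterᵇ)
open import Data.List.Membership.Propositional using (_∈_; lose)
open import Data.List.Membership.Propositional.Properties using (∈-map⁺; ∈-concatMap⁺)
open import Data.List.Relation.Unary.Any using (here; there)
import Data.List.Properties as List
open import Data.Nat as ℕ using (ℕ; zero; suc; _+_; _∸_; _≤_; _<_; z≤n; s≤s)
open import Data.Nat.Coprimality using (1-coprimeTo) renaming (sym to coprime-sym)
open import Data.Nat.ListAction using (sum)
import Data.Nat.Properties as ℕ
open import Data.List.Membership.DecPropositional ℕ._≟_ using (_∈?_)
open import Data.Product using (_×_; _,_; proj₁; proj₂)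
open import Data.Rational using (ℚ; 0ℚ; 1ℚ; _*_; _-_; mkℚ; toℚᵘ; nonNegative)
  renaming (_+_ to _+ℚ_; _≤_ to _≤ℚ_)
import Data.Rational.Properties as ℚ
open import Data.Rational.Solver using (module +-*-Solver)
import Data.Rational.Unnormalised as ℚᵘ
import Data.Rational.Unnormalised.Properties as ℚᵘ
open import Data.Sum using (inj₁; inj₂; [_,_]′)
open import Data.Vec using (Vec; toList)
open import Data.Vec.Relation.Unary.All using (All)
open import Function using (_∘_)
open import Relation.Binary.PropositionalEquality
open import Relation.Nullary.Decidable using (does; yes; no; dec-true; dec-false; toSum)

open +-*-Solver

sumℚ-++ : ∀ xs ys → sumℚ (xs ++ ys) ≡ sumℚ xs +ℚ sumℚ ys
sumℚ-++ []       ys = sym (ℚ.+-identityˡ _)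
sumℚ-++ (x ∷ xs) ys = trans (cong (x +ℚ_) (sumℚ-++ xs ys)) (sym (ℚ.+-assoc x _ _))

module _ {A : Set} where

  sumℚ-cong : ∀ {f g : A → ℚ} xs → (∀ {x} → x ∈ xs → f x ≡ g x) →
              sumℚ (map f xs) ≡ sumℚ (map g xs)
  sumℚ-cong []       eq = refl
  sumℚ-cong (x ∷ xs) eq = cong₂ _+ℚ_ (eq (here refl)) (sumℚ-cong xs (eq ∘ there))

  sumℚ-+ : ∀ (f g : A → ℚ) xs →
           sumℚ (map (λ x → f x +ℚ g x) xs) ≡ sumℚ (map f xs) +ℚ sumℚ (map g xs)
  sumℚ-+ f g []       = refl
  sumℚ-+ f g (x ∷ xs) = begin
    (f x +ℚ g x) +ℚ sumℚ (map (λ x → f x +ℚ g x) xs)   ≡⟨ cong ((f x +ℚ g x) +ℚ_) (sumℚ-+ f g xs) ⟩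
    (f x +ℚ g x) +ℚ (sumℚ (map f xs) +ℚ sumℚ (map g xs)) ≡⟨ ℚ.+-assoc (f x) (g x) _ ⟩
    f x +ℚ (g x +ℚ (sumℚ (map f xs) +ℚ sumℚ (map g xs))) ≡⟨ cong (f x +ℚ_) (x+[y+z]≡y+[x+z] (g x) (sumℚ (map f xs)) _) ⟩
    f x +ℚ (sumℚ (map f xs) +ℚ (g x +ℚ sumℚ (map g xs))) ≡⟨ ℚ.+-assoc (f x) (sumℚ (map f xs)) _ ⟨
    (f x +ℚ sumℚ (map f xs)) +ℚ (g x +ℚ sumℚ (map g xs)) ∎
    where
    open ≡-Reasoning
    x+[y+z]≡y+[x+z] : ∀ a b c → a +ℚ (b +ℚ c) ≡ b +ℚ (a +ℚ c)
    x+[y+z]≡y+[x+z] a b c = trans (sym (ℚ.+-assoc a b c))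
      (trans (cong (_+ℚ c) (ℚ.+-comm a b)) (ℚ.+-assoc b a c))

  sumℚ-*ˡ : ∀ c (f : A → ℚ) xs → sumℚ (map (λ x → c * f x) xs) ≡ c * sumℚ (map f xs)
  sumℚ-*ˡ c f []       = sym (ℚ.*-zeroʳ c)
  sumℚ-*ˡ c f (x ∷ xs) = trans (cong (c * f x +ℚ_) (sumℚ-*ˡ c f xs)) (sym (ℚ.*-distribˡ-+ c (f x) _))

  sumℚ-zero : ∀ (xs : List A) → sumℚ (map (λ _ → 0ℚ) xs) ≡ 0ℚ
  sumℚ-zero []       = refl
  sumℚ-zero (x ∷ xs) = trans (ℚ.+-identityˡ _) (sumℚ-zero xs)

  sumℚ-concatMap : ∀ {B : Set} (w : B → ℚ) (f : A → List B) xs →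
    sumℚ (map w (concatMap f xs)) ≡ sumℚ (map (λ x → sumℚ (map w (f x))) xs)
  sumℚ-concatMap w f []       = refl
  sumℚ-concatMap w f (x ∷ xs) = begin
    sumℚ (map w (f x ++ concatMap f xs))                  ≡⟨ cong sumℚ (List.map-++ w (f x) _) ⟩
    sumℚ (map w (f x) ++ map w (concatMap f xs))          ≡⟨ sumℚ-++ (map w (f x)) _ ⟩
    sumℚ (map w (f x)) +ℚ sumℚ (map w (concatMap f xs))   ≡⟨ cong (sumℚ (map w (f x)) +ℚ_) (sumℚ-concatMap w f xs) ⟩
    sumℚ (map w (f x)) +ℚ sumℚ (map (λ x → sumℚ (map w (f x))) xs) ∎
    where open ≡-Reasoning

  filterᵇ-map : ∀ {B : Set} (p : B → Bool) (f : A → B) xs →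
    filterᵇ p (map f xs) ≡ map f (filterᵇ (p ∘ f) xs)
  filterᵇ-map p f []       = refl
  filterᵇ-map p f (x ∷ xs) with p (f x)
  ... | true  = cong (f x ∷_) (filterᵇ-map p f xs)
  ... | false = filterᵇ-map p f xs

  filterᵇ-cong : ∀ {p q : A → Bool} → (∀ x → p x ≡ q x) → ∀ xs → filterᵇ p xs ≡ filterᵇ q xs
  filterᵇ-cong {p} {q} eq []       = refl
  filterᵇ-cong {p} {q} eq (x ∷ xs) with p x | q x | eq x
  ... | true  | true  | refl = cong (x ∷_) (filterᵇ-cong eq xs)
  ... | false | false | refl = filterᵇ-cong eq xs

  filterᵇ-none : ∀ {p : A → Bool} → (∀ x → p x ≡ false) → ∀ xs → filterᵇ p xs ≡ []
  filterᵇ-none {p} none []       = refl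
  filterᵇ-none {p} none (x ∷ xs) with p x | none x
  ... | false | refl = filterᵇ-none none xs

  filterᵇ-concatMap : ∀ {B : Set} (p : B → Bool) (f : A → List B) xs →
    filterᵇ p (concatMap f xs) ≡ concatMap (filterᵇ p ∘ f) xs
  filterᵇ-concatMap p f []       = refl
  filterᵇ-concatMap p f (x ∷ xs) =
    trans (List.filter-++ (T? ∘ p) (f x) _) (cong (filterᵇ p (f x) ++_) (filterᵇ-concatMap p f xs))

  allᵇ-cong : ∀ {p q : A → Bool} → (∀ x → p x ≡ q x) → ∀ xs → allᵇ p xs ≡ allᵇ q xs
  allᵇ-cong eq []       = refl
  allᵇ-cong eq (x ∷ xs) rewrite eq x | allᵇ-cong eq xs = refl

  allᵇ-false : ∀ {p : A → Bool} {x xs} → x ∈ xs → p x ≡ false → allᵇ p xs ≡ false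
  allᵇ-false {p} (here refl) px rewrite px = refl
  allᵇ-false {p} {xs = y ∷ _} (there x∈xs) px with p y
  ... | true  = allᵇ-false x∈xs px
  ... | false = refl

==E-refl : ∀ e → (e ==E e) ≡ true
==E-refl e = dec-true (e ≟E e) refl

==E-≢ : ∀ {e f} → e ≢ f → (e ==E f) ≡ false
==E-≢ {e} {f} = dec-false (e ≟E f)

δ : Edge → ℚ → Edge → ℚ
δ h A x = if x ==E h then A else 0ℚ

δ-≢ : ∀ h A x → x ≢ h → δ h A x ≡ 0ℚ
δ-≢ h A x x≢h = cong (if_then A else 0ℚ) (==E-≢ x≢h)

δ-self : ∀ h A → δ h A h ≡ A
δ-self h A = cong (if_then A else 0ℚ) (==E-refl h)

∈-range : ∀ {a s} c → s ≤ a → a < s + c → a ∈ range s c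
∈-range {a} {s} zero    s≤a a<s+0 = ⊥-elim (ℕ.<⇒≱ (subst (a <_) (ℕ.+-identityʳ s) a<s+0) s≤a)
∈-range {a} {s} (suc c) s≤a a<s+c with s ℕ.≟ a
... | yes refl = here refl
... | no  s≢a  = there (∈-range c (ℕ.≤∧≢⇒< s≤a s≢a) (subst (a <_) (ℕ.+-suc s c) a<s+c))

sumℚ-range-none : ∀ (g : ℕ → ℚ) {a} → (∀ i → i ≢ a → g i ≡ 0ℚ) →
                  ∀ {s} c → a < s → sumℚ (map g (range s c)) ≡ 0ℚ
sumℚ-range-none g off zero    a<s = refl
sumℚ-range-none g off {s} (suc c) a<s =
  cong₂ _+ℚ_ (off s (ℕ.>⇒≢ a<s)) (sumℚ-range-none g off c (ℕ.m<n⇒m<1+n a<s))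

sumℚ-range-single : ∀ (g : ℕ → ℚ) {a} → (∀ i → i ≢ a → g i ≡ 0ℚ) →
                    ∀ {s} c → s ≤ a → a < s + c → sumℚ (map g (range s c)) ≡ g a
sumℚ-range-single g {a} off {s} zero    s≤a a<s+0 = ⊥-elim (ℕ.<⇒≱ (subst (a <_) (ℕ.+-identityʳ s) a<s+0) s≤a)
sumℚ-range-single g {a} off {s} (suc c) s≤a a<s+c with s ℕ.≟ a
... | yes refl = trans (cong (g s +ℚ_) (sumℚ-range-none g off c (ℕ.n<1+n s))) (ℚ.+-identityʳ (g s))
... | no  s≢a  = trans (cong (_+ℚ sumℚ (map g (range (suc s) c))) (off s s≢a)) (trans (ℚ.+-identityˡ _)
                   (sumℚ-range-single g off c (ℕ.≤∧≢⇒< s≤a s≢a) (subst (a <_) (ℕ.+-suc s c) a<s+c)))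

module _ {n a b : ℕ} (1≤a : 1 ≤ a) (a<b : a < b) (b≤n : b ≤ n) where

  private
    a<n : a < n
    a<n = ℕ.<-≤-trans a<b b≤n

    a<1+n : a < 1 + n
    a<1+n = ℕ.m<n⇒m<1+n a<n

    b<a+1+[n∸a] : b < suc a + (n ∸ a)
    b<a+1+[n∸a] = s≤s (subst (b ≤_) (sym (ℕ.m+[n∸m]≡n (ℕ.<⇒≤ a<n))) b≤n)

  ∈-edges : (a , b) ∈ edges n
  ∈-edges = ∈-concatMap⁺ (λ i → map (i ,_) (range (suc i) (n ∸ i)))
              (lose (∈-range n 1≤a a<1+n) (∈-map⁺ (a ,_) (∈-range (n ∸ a) a<b b<a+1+[n∸a])))

  sumℚ-edges-δ : ∀ A → sumℚ (map (δ (a , b) A) (edges n)) ≡ A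
  sumℚ-edges-δ A = begin
    sumℚ (map (δ (a , b) A) (edges n))       ≡⟨ sumℚ-concatMap (δ (a , b) A) row (range 1 n) ⟩
    sumℚ (map rowSum (range 1 n))            ≡⟨ sumℚ-range-single rowSum rowSum-≢ n 1≤a a<1+n ⟩
    rowSum a                                 ≡⟨ cong sumℚ (List.map-∘ (range (suc a) (n ∸ a))) ⟨
    sumℚ (map (λ j → δ (a , b) A (a , j)) (range (suc a) (n ∸ a)))
      ≡⟨ sumℚ-range-single (λ j → δ (a , b) A (a , j)) (λ j j≢b → δ-≢ (a , b) A (a , j) (j≢b ∘ cong proj₂))
                           (n ∸ a) a<b b<a+1+[n∸a] ⟩
    δ (a , b) A (a , b)                      ≡⟨ δ-self (a , b) A ⟩
    A ∎
    where
    open ≡-Reasoning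
    row : ℕ → List Edge
    row i = map (i ,_) (range (suc i) (n ∸ i))
    rowSum : ℕ → ℚ
    rowSum i = sumℚ (map (δ (a , b) A) (row i))
    rowSum-≢ : ∀ i → i ≢ a → rowSum i ≡ 0ℚ
    rowSum-≢ i i≢a = begin
      rowSum i ≡⟨ cong sumℚ (List.map-∘ (range (suc i) (n ∸ i))) ⟨
      sumℚ (map (λ j → δ (a , b) A (i , j)) (range (suc i) (n ∸ i)))
        ≡⟨ sumℚ-cong (range (suc i) (n ∸ i)) (λ {j} _ → δ-≢ (a , b) A (i , j) (i≢a ∘ cong proj₁)) ⟩
      sumℚ (map (λ _ → 0ℚ) (range (suc i) (n ∸ i))) ≡⟨ sumℚ-zero (range (suc i) (n ∸ i)) ⟩
      0ℚ ∎

_∈ᵇ_ : ℕ → List ℕ → Bool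
y ∈ᵇ ws = does (y ∈? ws)

insertEdge : Edge → List ℕ → List ℕ
insertEdge (a , c) vs = insertV c (insertV a vs)

∈ᵇ-insertV : ∀ y a ws → y ∈ᵇ insertV a ws ≡ does (y ℕ.≟ a) ∨ y ∈ᵇ ws
∈ᵇ-insertV y a ws with a ∈ᵇ ws in a∈ws
... | false = refl
... | true with y ℕ.≟ a
...   | yes refl = trans a∈ws (sym (trans (cong (does (a ℕ.≟ a) ∨_) a∈ws) (∨-zeroʳ _)))
...   | no  y≢a  = sym (cong (_∨ y ∈ᵇ ws) (dec-false (y ℕ.≟ a) y≢a))

∈ᵇ-insertV-≢ : ∀ {y a} ws → y ≢ a → y ∈ᵇ insertV a ws ≡ y ∈ᵇ ws
∈ᵇ-insertV-≢ {y} {a} ws y≢a = trans (∈ᵇ-insertV y a ws) (cong (_∨ y ∈ᵇ ws) (dec-false (y ℕ.≟ a) y≢a))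

∈ᵇ-insertV-self : ∀ a ws → a ∈ᵇ insertV a ws ≡ true
∈ᵇ-insertV-self a ws = trans (∈ᵇ-insertV a a ws) (cong (_∨ a ∈ᵇ ws) (dec-true (a ℕ.≟ a) refl))

∈ᵇ-insertV-mono : ∀ {y} a ws → y ∈ᵇ ws ≡ true → y ∈ᵇ insertV a ws ≡ true
∈ᵇ-insertV-mono {y} a ws y∈ws = trans (∈ᵇ-insertV y a ws) (trans (cong (does (y ℕ.≟ a) ∨_) y∈ws) (∨-zeroʳ _))

length-insertV : ∀ a ws → length (insertV a ws) ≡ (if a ∈ᵇ ws then length ws else suc (length ws))
length-insertV a ws with a ∈ᵇ ws
... | true  = refl
... | false = refl

∈ᵇ-insertEdge : ∀ y h ws → y ∈ᵇ insertEdge h ws ≡ does (y ℕ.≟ proj₂ h) ∨ (does (y ℕ.≟ proj₁ h) ∨ y ∈ᵇ ws)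
∈ᵇ-insertEdge y (p , q) ws = trans (∈ᵇ-insertV y q (insertV p ws)) (cong (does (y ℕ.≟ q) ∨_) (∈ᵇ-insertV y p ws))

absent : ℕ → List ℕ → ℕ
absent y ws = if y ∈ᵇ ws then 0 else 1

newVertices : Edge → List ℕ → ℕ
newVertices (p , q) ws = absent p ws + absent q ws

length-insertEdge : ∀ {p q} ws → q ≢ p → length (insertEdge (p , q) ws) ≡ length ws + newVertices (p , q) ws
length-insertEdge {p} {q} ws q≢p
  rewrite length-insertV q (insertV p ws) | ∈ᵇ-insertV-≢ ws q≢p | length-insertV p ws
  with p ∈ᵇ ws | q ∈ᵇ ws
... | true  | true  = sym (ℕ.+-identityʳ _)
... | true  | false = ℕ.+-comm 1 _
... | false | true  = ℕ.+-comm 1 _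
... | false | false = ℕ.+-comm 2 _

newVertices-insertEdge-self : ∀ h ws → newVertices h (insertEdge h ws) ≡ 0
newVertices-insertEdge-self (p , q) ws
  rewrite ∈ᵇ-insertV-mono q (insertV p ws) (∈ᵇ-insertV-self p ws) | ∈ᵇ-insertV-self q (insertV p ws) = refl

≟-+ˡ : ∀ k i j → does (k + i ℕ.≟ k + j) ≡ does (i ℕ.≟ j)
≟-+ˡ k i j with i ℕ.≟ j
... | yes refl = trans (dec-true (k + i ℕ.≟ k + i) refl) (sym (dec-true (i ℕ.≟ i) refl))
... | no  i≢j  = trans (dec-false (k + i ℕ.≟ k + j) (i≢j ∘ ℕ.+-cancelˡ-≡ k i j)) (sym (dec-false (i ℕ.≟ j) i≢j))

-- For literals a, b, a′, b′ the right-hand side evaluates; the left-hand side is stuck on k.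
newVertices-+ˡ : ∀ k a b a′ b′ →
  newVertices (k + a′ , k + b′) (insertEdge (k + a , k + b) []) ≡ newVertices (a′ , b′) (insertEdge (a , b) [])
newVertices-+ˡ k a b a′ b′ = cong₂ _+_ (cong (if_then 0 else 1) (shifted a′)) (cong (if_then 0 else 1) (shifted b′))
  where
  shifted : ∀ y → (k + y) ∈ᵇ insertEdge (k + a , k + b) [] ≡ y ∈ᵇ insertEdge (a , b) []
  shifted y = trans (∈ᵇ-insertEdge (k + y) (k + a , k + b) [])
    (trans (cong₂ (λ p q → p ∨ (q ∨ false)) (≟-+ˡ k y b) (≟-+ˡ k y a)) (sym (∈ᵇ-insertEdge y (a , b) [])))

v-self : ∀ x → v x x ≡ 1
v-self x = cong (if_then 1 else 0) (==E-refl x)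

v-≢ : ∀ {x y} → x ≢ y → v x y ≡ 0
v-≢ x≢y = cong (if_then 1 else 0) (==E-≢ x≢y)

_⊖_ : (Edge → ℕ) → Edge → (Edge → ℕ)
(α ⊖ x) y = α y ∸ v x y

multiplicity-cons : ∀ x F e →
  multiplicity (x ∷ F) e ≡ (if x ==E e then suc (multiplicity F e) else multiplicity F e)
multiplicity-cons x F e with x ==E e
... | true  = refl
... | false = refl

multiplicity-InUnion : ∀ es x {j} → multiplicity es x ≡ suc j → InUnion (proj₁ x) es × InUnion (proj₂ x) es
multiplicity-InUnion ((a , c) ∷ es) x eq with (a , c) ≟E x
... | yes refl = inj₁ refl , inj₂ (inj₁ refl)
... | no  _    with multiplicity-InUnion es x eq
...   | inA , inC = inj₂ (inj₂ inA) , inj₂ (inj₂ inC)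

module _ (n : ℕ) where

  matches-cong : ∀ {α β} F → α ≗ β → matches n α F ≡ matches n β F
  matches-cong F α≗β = allᵇ-cong (λ e → cong (λ z → does (multiplicity F e ℕ.≟ z)) (α≗β e)) (edges n)

  matches-cons : ∀ {α x j} F → α x ≡ suc j → matches n α (x ∷ F) ≡ matches n (α ⊖ x) F
  matches-cons {α} {x} F αx≡1+j = allᵇ-cong agree (edges n)
    where
    agree : ∀ e → does (multiplicity (x ∷ F) e ℕ.≟ α e) ≡ does (multiplicity F e ℕ.≟ (α ⊖ x) e)
    agree e with x ≟E e
    ... | yes refl rewrite αx≡1+j = refl
    ... | no  _    = refl

  matches-cons-zero : ∀ {α x} F → α x ≡ 0 → x ∈ edges n → matches n α (x ∷ F) ≡ false
  matches-cons-zero {α} {x} F αx≡0 x∈edges = allᵇ-false x∈edges mismatch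
    where
    mismatch : does (multiplicity (x ∷ F) x ℕ.≟ α x) ≡ false
    mismatch rewrite multiplicity-cons x F x | ==E-refl x | αx≡0 = refl

  matches-[]-false : ∀ {α h j} → α h ≡ suc j → h ∈ edges n → matches n α [] ≡ false
  matches-[]-false {α} {h} αh≡1+j h∈edges = allᵇ-false h∈edges mismatch
    where
    mismatch : does (0 ℕ.≟ α h) ≡ false
    mismatch rewrite αh≡1+j = refl

-- Nonnegative, decreasing, convex triples

0≤+ : ∀ {p q} → 0ℚ ≤ℚ p → 0ℚ ≤ℚ q → 0ℚ ≤ℚ p +ℚ q
0≤+ {p} {q} 0≤p 0≤q =
  ℚ.nonNegative⁻¹ _ {{ℚ.nonNeg+nonNeg⇒nonNeg p {{nonNegative 0≤p}} q {{nonNegative 0≤q}}}}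

0≤* : ∀ {p q} → 0ℚ ≤ℚ p → 0ℚ ≤ℚ q → 0ℚ ≤ℚ p * q
0≤* {p} {q} 0≤p 0≤q =
  ℚ.nonNegative⁻¹ _ {{ℚ.nonNeg*nonNeg⇒nonNeg p {{nonNegative 0≤p}} q {{nonNegative 0≤q}}}}

0≤-≡ : ∀ {p q} → p ≡ q → 0ℚ ≤ℚ q → 0ℚ ≤ℚ p
0≤-≡ refl 0≤q = 0≤q

0≤inv : ∀ m → 0ℚ ≤ℚ inv m
0≤inv zero    = ℚ.≤-refl
0≤inv (suc m) = ℚ.nonNegative⁻¹ _ {{ℚ.normalize-nonNeg 1 (suc m)}}

-- f₀ ≥ f₁ ≥ f₂ ≥ 0 and f₀ + f₂ ≥ 2 f₁; unlike convexity alone, this is preserved by products.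
record DecreasingConvex (f₀ f₁ f₂ : ℚ) : Set where
  constructor decreasingConvex
  field
    nonneg₂     : 0ℚ ≤ℚ f₂
    decreasing₁ : 0ℚ ≤ℚ f₁ - f₂
    decreasing₀ : 0ℚ ≤ℚ f₀ - f₁
    convex      : 0ℚ ≤ℚ (f₀ +ℚ f₂) - (f₁ +ℚ f₁)

  nonneg₁ : 0ℚ ≤ℚ f₁
  nonneg₁ = 0≤-≡ (solve 2 (λ x y → x := (x :- y) :+ y) refl f₁ f₂) (0≤+ decreasing₁ nonneg₂)

  nonneg₀ : 0ℚ ≤ℚ f₀
  nonneg₀ = 0≤-≡ (solve 2 (λ x y → x := (x :- y) :+ y) refl f₀ f₁) (0≤+ decreasing₀ nonneg₁)

open DecreasingConvex

DC-const : ∀ {c} → 0ℚ ≤ℚ c → DecreasingConvex c c c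
DC-const {c} 0≤c = decreasingConvex 0≤c 0≤c-c 0≤c-c (0≤-≡ (ℚ.+-inverseʳ (c +ℚ c)) ℚ.≤-refl)
  where
  0≤c-c : 0ℚ ≤ℚ c - c
  0≤c-c = 0≤-≡ (ℚ.+-inverseʳ c) ℚ.≤-refl

DC-+ : ∀ {f₀ f₁ f₂ g₀ g₁ g₂} → DecreasingConvex f₀ f₁ f₂ → DecreasingConvex g₀ g₁ g₂ →
       DecreasingConvex (f₀ +ℚ g₀) (f₁ +ℚ g₁) (f₂ +ℚ g₂)
DC-+ {f₀} {f₁} {f₂} {g₀} {g₁} {g₂} F G = decreasingConvex
  (0≤+ (nonneg₂ F) (nonneg₂ G))
  (0≤-≡ (difference f₁ f₂ g₁ g₂) (0≤+ (decreasing₁ F) (decreasing₁ G)))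
  (0≤-≡ (difference f₀ f₁ g₀ g₁) (0≤+ (decreasing₀ F) (decreasing₀ G)))
  (0≤-≡ (solve 6 (λ f₀ f₁ f₂ g₀ g₁ g₂ → ((f₀ :+ g₀) :+ (f₂ :+ g₂)) :- ((f₁ :+ g₁) :+ (f₁ :+ g₁))
                    := ((f₀ :+ f₂) :- (f₁ :+ f₁)) :+ ((g₀ :+ g₂) :- (g₁ :+ g₁))) refl f₀ f₁ f₂ g₀ g₁ g₂)
        (0≤+ (convex F) (convex G)))
  where
  difference : ∀ a b c d → (a +ℚ c) - (b +ℚ d) ≡ (a - b) +ℚ (c - d)
  difference = solve 4 (λ a b c d → (a :+ c) :- (b :+ d) := (a :- b) :+ (c :- d)) refl

DC-* : ∀ {f₀ f₁ f₂ g₀ g₁ g₂} → DecreasingConvex f₀ f₁ f₂ → DecreasingConvex g₀ g₁ g₂ →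
       DecreasingConvex (f₀ * g₀) (f₁ * g₁) (f₂ * g₂)
DC-* {f₀} {f₁} {f₂} {g₀} {g₁} {g₂} F G = decreasingConvex
  (0≤* (nonneg₂ F) (nonneg₂ G))
  (0≤-≡ (difference f₁ f₂ g₁ g₂) (0≤+ (0≤* (nonneg₁ F) (decreasing₁ G)) (0≤* (nonneg₂ G) (decreasing₁ F))))
  (0≤-≡ (difference f₀ f₁ g₀ g₁) (0≤+ (0≤* (nonneg₀ F) (decreasing₀ G)) (0≤* (nonneg₁ G) (decreasing₀ F))))
  (0≤-≡ (solve 6 (λ f₀ f₁ f₂ g₀ g₁ g₂ → ((f₀ :* g₀) :+ (f₂ :* g₂)) :- ((f₁ :* g₁) :+ (f₁ :* g₁))
                    := (f₁ :* ((g₀ :+ g₂) :- (g₁ :+ g₁)) :+ g₁ :* ((f₀ :+ f₂) :- (f₁ :+ f₁)))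
                       :+ ((f₀ :- f₁) :* (g₀ :- g₁) :+ (f₁ :- f₂) :* (g₁ :- g₂))) refl f₀ f₁ f₂ g₀ g₁ g₂)
        (0≤+ (0≤+ (0≤* (nonneg₁ F) (convex G)) (0≤* (nonneg₁ G) (convex F)))
             (0≤+ (0≤* (decreasing₀ F) (decreasing₀ G)) (0≤* (decreasing₁ F) (decreasing₁ G)))))
  where
  difference : ∀ a b c d → (a * c) - (b * d) ≡ a * (c - d) +ℚ d * (a - b)
  difference = solve 4 (λ a b c d → (a :* c) :- (b :* d) := a :* (c :- d) :+ d :* (a :- b)) refl

DC-*ˡ : ∀ {w f₀ f₁ f₂} → 0ℚ ≤ℚ w → DecreasingConvex f₀ f₁ f₂ → DecreasingConvex (w * f₀) (w * f₁) (w * f₂)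
DC-*ˡ 0≤w = DC-* (DC-const 0≤w)

DC-sum : ∀ {A : Set} {f₀ f₁ f₂ : A → ℚ} xs → (∀ x → DecreasingConvex (f₀ x) (f₁ x) (f₂ x)) →
         DecreasingConvex (sumℚ (map f₀ xs)) (sumℚ (map f₁ xs)) (sumℚ (map f₂ xs))
DC-sum []       F = DC-const ℚ.≤-refl
DC-sum (x ∷ xs) F = DC-+ (F x) (DC-sum xs F)

private
  ℕtoℚ-suc : ∀ m → ℕtoℚ (suc m) ≡ ℕtoℚ m +ℚ 1ℚ
  ℕtoℚ-suc m = ℚ.toℚᵘ-injective (ℚᵘ.≃-trans lhs (ℚᵘ.≃-sym (ℚ.toℚᵘ-homo-+ (ℕtoℚ m) 1ℚ)))
    where
    open ℤSolver.+-*-Solver renaming (solve to solveℤ; _:=_ to _:=ℤ_; _:+_ to _:+ℤ_; _:*_ to _:*ℤ_; con to conℤ)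
    lhs : toℚᵘ (ℕtoℚ (suc m)) ℚᵘ.≃ (toℚᵘ (ℕtoℚ m) ℚᵘ.+ toℚᵘ 1ℚ)
    lhs rewrite ℚ.normalize-coprime (coprime-sym (1-coprimeTo (suc m)))
              | ℚ.normalize-coprime (coprime-sym (1-coprimeTo m)) =
      ℚᵘ.*≡* (solveℤ 1 (λ x → (conℤ (+ 1) :+ℤ x) :*ℤ conℤ (+ 1)
                               :=ℤ (x :*ℤ conℤ (+ 1) :+ℤ conℤ (+ 1) :*ℤ conℤ (+ 1)) :*ℤ conℤ (+ 1)) refl (+ m))

  inv*ℕtoℚ : ∀ m → inv (suc m) * ℕtoℚ (suc m) ≡ 1ℚ
  inv*ℕtoℚ m rewrite ℚ.normalize-coprime (1-coprimeTo (suc m))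
                   | ℚ.normalize-coprime (coprime-sym (1-coprimeTo (suc m))) =
    ℚ.*-inverseˡ (mkℚ (+ suc m) 0 (coprime-sym (1-coprimeTo (suc m))))

  inv-difference : ∀ m → inv (suc m) - inv (suc (suc m)) ≡ inv (suc m) * inv (suc (suc m))
  inv-difference m = begin
    p - q
      ≡⟨ cong₂ _-_ (trans (cong (p *_) q*[M+1]≡1) (ℚ.*-identityʳ p)) (trans (cong (q *_) p*M≡1) (ℚ.*-identityʳ q)) ⟨
    p * (q * (M +ℚ 1ℚ)) - q * (p * M)
      ≡⟨ solve 3 (λ p q M → p :* (q :* (M :+ con 1ℚ)) :- q :* (p :* M) := p :* q) refl p q M ⟩
    p * q ∎
    where
    open ≡-Reasoning
    p = inv (suc m)
    q = inv (suc (suc m))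
    M = ℕtoℚ (suc m)
    p*M≡1 : p * M ≡ 1ℚ
    p*M≡1 = inv*ℕtoℚ m
    q*[M+1]≡1 : q * (M +ℚ 1ℚ) ≡ 1ℚ
    q*[M+1]≡1 = trans (cong (q *_) (sym (ℕtoℚ-suc (suc m)))) (inv*ℕtoℚ (suc m))

  DC-inv-suc : ∀ t → DecreasingConvex (inv (suc t)) (inv (suc (suc t))) (inv (suc (suc (suc t))))
  DC-inv-suc t = decreasingConvex
    (0≤inv (3 + t))
    (0≤-≡ (inv-difference (suc t)) (0≤* (0≤inv (2 + t)) (0≤inv (3 + t))))
    (0≤-≡ (inv-difference t) (0≤* (0≤inv (1 + t)) (0≤inv (2 + t))))
    (0≤-≡ second-difference
      (0≤* (0≤inv (2 + t)) (0≤+ (0≤* (0≤inv (1 + t)) (0≤inv (2 + t))) (0≤* (0≤inv (2 + t)) (0≤inv (3 + t))))))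
    where
    p = inv (1 + t)
    q = inv (2 + t)
    r = inv (3 + t)
    second-difference : (p +ℚ r) - (q +ℚ q) ≡ q * (p * q +ℚ q * r)
    second-difference = begin
      (p +ℚ r) - (q +ℚ q)   ≡⟨ solve 3 (λ p q r → (p :+ r) :- (q :+ q) := (p :- q) :- (q :- r)) refl p q r ⟩
      (p - q) - (q - r)     ≡⟨ cong₂ _-_ (inv-difference t) (inv-difference (suc t)) ⟩
      p * q - q * r         ≡⟨ solve 3 (λ p q r → p :* q :- q :* r := q :* ((p :- q) :+ (q :- r))) refl p q r ⟩
      q * ((p - q) +ℚ (q - r)) ≡⟨ cong (q *_) (cong₂ _+ℚ_ (inv-difference t) (inv-difference (suc t))) ⟩
      q * (p * q +ℚ q * r) ∎
      where open ≡-Reasoning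

DC-≡ : ∀ {f₀ f₁ f₂ g₀ g₁ g₂} → f₀ ≡ g₀ → f₁ ≡ g₁ → f₂ ≡ g₂ →
       DecreasingConvex g₀ g₁ g₂ → DecreasingConvex f₀ f₁ f₂
DC-≡ refl refl refl G = G

DC-inv : ∀ L t → DecreasingConvex (inv (L + (1 + t))) (inv (L + (2 + t))) (inv (L + (3 + t)))
DC-inv L t = DC-≡ (cong inv L+[1+t]) (cong inv L+[2+t]) (cong inv L+[3+t]) (DC-inv-suc (L + t))
  where
  L+[1+t] : L + (1 + t) ≡ 1 + (L + t)
  L+[1+t] = ℕ.+-suc L t
  L+[2+t] : L + (2 + t) ≡ 2 + (L + t)
  L+[2+t] = trans (ℕ.+-suc L (1 + t)) (cong suc L+[1+t])
  L+[3+t] : L + (3 + t) ≡ 3 + (L + t)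
  L+[3+t] = trans (ℕ.+-suc L (2 + t)) (cong suc L+[2+t])

-- Counting sequences step by step

whenPos : ℕ → ℚ → ℚ
whenPos zero    _ = 0ℚ
whenPos (suc _) q = q

whenPos-cong : ∀ {a b q r} → a ≡ b → (∀ j → b ≡ suc j → q ≡ r) → whenPos a q ≡ whenPos b r
whenPos-cong {b = zero}  refl _    = refl
whenPos-cong {b = suc j} refl q≡r = q≡r j refl

whenPos-*-distribˡ-+ : ∀ g a b c → whenPos g (a * (b +ℚ c)) ≡ whenPos g (a * b) +ℚ whenPos g (a * c)
whenPos-*-distribˡ-+ zero    a b c = refl
whenPos-*-distribˡ-+ (suc _) a b c = ℚ.*-distribˡ-+ a b c

DC-whenPos : ∀ g {f₀ f₁ f₂} → DecreasingConvex f₀ f₁ f₂ →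
             DecreasingConvex (whenPos g f₀) (whenPos g f₁) (whenPos g f₂)
DC-whenPos zero    _ = DC-const ℚ.≤-refl
DC-whenPos (suc g) F = F

module _ (n : ℕ) where

  -- b n d α = countFrom [] α d.
  countFrom : List ℕ → (Edge → ℕ) → ℕ → ℚ
  countFrom vs α m = sumℚ (map (weightFrom vs) (filterᵇ (matches n α) (seqs (edges n) m)))

  firstStep : List ℕ → (Edge → ℕ) → ℕ → Edge → ℚ
  firstStep vs α m x = whenPos (α x) (inv (length (insertEdge x vs)) * countFrom (insertEdge x vs) (α ⊖ x) m)

  countFrom-zero : ∀ vs α → countFrom vs α 0 ≡ (if matches n α [] then 1ℚ else 0ℚ)
  countFrom-zero vs α with matches n α []
  ... | true  = refl
  ... | false = refl

  countFrom-suc : ∀ vs α m → countFrom vs α (suc m) ≡ sumℚ (map (firstStep vs α m) (edges n))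
  countFrom-suc vs α m = begin
    sumℚ (map (weightFrom vs) (filterᵇ (matches n α) (concatMap prefixed (edges n))))
      ≡⟨ cong (sumℚ ∘ map (weightFrom vs)) (filterᵇ-concatMap (matches n α) prefixed (edges n)) ⟩
    sumℚ (map (weightFrom vs) (concatMap (filterᵇ (matches n α) ∘ prefixed) (edges n)))
      ≡⟨ sumℚ-concatMap (weightFrom vs) (filterᵇ (matches n α) ∘ prefixed) (edges n) ⟩
    sumℚ (map (λ x → sumℚ (map (weightFrom vs) (filterᵇ (matches n α) (prefixed x)))) (edges n))
      ≡⟨ sumℚ-cong (edges n) (λ {x} → startingWith x) ⟩
    sumℚ (map (firstStep vs α m) (edges n)) ∎
    where
    open ≡-Reasoning
    prefixed : Edge → List (List Edge)
    prefixed x = map (x ∷_) (seqs (edges n) m)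

    startingWith : ∀ x → x ∈ edges n →
      sumℚ (map (weightFrom vs) (filterᵇ (matches n α) (prefixed x)))
        ≡ whenPos (α x) (inv (length (insertEdge x vs)) * countFrom (insertEdge x vs) (α ⊖ x) m)
    startingWith x x∈edges with α x in αx
    ... | zero = cong (sumℚ ∘ map (weightFrom vs)) (begin
      filterᵇ (matches n α) (prefixed x)
        ≡⟨ filterᵇ-map (matches n α) (x ∷_) (seqs (edges n) m) ⟩
      map (x ∷_) (filterᵇ (matches n α ∘ (x ∷_)) (seqs (edges n) m))
        ≡⟨ cong (map (x ∷_)) (filterᵇ-none (λ F → matches-cons-zero n {α} {x} F αx x∈edges) (seqs (edges n) m)) ⟩
      [] ∎)
    ... | suc j = begin
      sumℚ (map (weightFrom vs) (filterᵇ (matches n α) (prefixed x)))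
        ≡⟨ cong (sumℚ ∘ map (weightFrom vs)) (filterᵇ-map (matches n α) (x ∷_) (seqs (edges n) m)) ⟩
      sumℚ (map (weightFrom vs) (map (x ∷_) (filterᵇ (matches n α ∘ (x ∷_)) (seqs (edges n) m))))
        ≡⟨ cong (sumℚ ∘ map (weightFrom vs) ∘ map (x ∷_))
                (filterᵇ-cong (λ F → matches-cons n {α} {x} F αx) (seqs (edges n) m)) ⟩
      sumℚ (map (weightFrom vs) (map (x ∷_) S))                  ≡⟨ cong sumℚ (List.map-∘ S) ⟨
      sumℚ (map (λ F → inv (length (insertEdge x vs)) * weightFrom (insertEdge x vs) F) S)
        ≡⟨ sumℚ-*ˡ (inv (length (insertEdge x vs))) (weightFrom (insertEdge x vs)) S ⟩
      inv (length (insertEdge x vs)) * countFrom (insertEdge x vs) (α ⊖ x) m ∎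
      where S = filterᵇ (matches n (α ⊖ x)) (seqs (edges n) m)

  finished : List ℕ → (Edge → ℕ) → ℚ
  finished []      γ = if matches n γ [] then 1ℚ else 0ℚ
  finished (_ ∷ _) γ = 0ℚ

  -- shiftedCount vK s cs γ m is countFrom vK γ m with every vertex count raised by s, except that
  -- the m steps must also place, in order, extra edges bringing cs₁, cs₂, … new vertices each
  -- (which from then on add to the shift).
  shiftedCount : List ℕ → ℕ → List ℕ → (Edge → ℕ) → ℕ → ℚ
  shiftedStep  : List ℕ → ℕ → List ℕ → (Edge → ℕ) → ℕ → Edge → ℚ
  pendingStep  : List ℕ → ℕ → List ℕ → (Edge → ℕ) → ℕ → ℚ

  shiftedCount vK s cs γ zero    = finished cs γ
  shiftedCount vK s cs γ (suc m) = sumℚ (map (shiftedStep vK s cs γ m) (edges n)) +ℚ pendingStep vK s cs γ m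

  shiftedStep vK s cs γ m x =
    whenPos (γ x) (inv (length (insertEdge x vK) + s) * shiftedCount (insertEdge x vK) s cs (γ ⊖ x) m)

  pendingStep vK s []       γ m = 0ℚ
  pendingStep vK s (c ∷ cs) γ m = inv (length vK + (c + s)) * shiftedCount vK (c + s) cs γ m

  shiftedCount-convex-shift : ∀ m vK t γ →
    DecreasingConvex (shiftedCount vK (1 + t) [] γ m) (shiftedCount vK (2 + t) [] γ m)
                     (shiftedCount vK (3 + t) [] γ m)
  shiftedCount-convex-shift zero    vK t γ = DC-const (0≤finished (matches n γ []))
    where
    0≤finished : ∀ b → 0ℚ ≤ℚ (if b then 1ℚ else 0ℚ)
    0≤finished true  = ℚ.nonNegative⁻¹ 1ℚ
    0≤finished false = ℚ.≤-refl
  shiftedCount-convex-shift (suc m) vK t γ = DC-+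
    (DC-sum (edges n) λ x → DC-whenPos (γ x)
      (DC-* (DC-inv (length (insertEdge x vK)) t) (shiftedCount-convex-shift m (insertEdge x vK) t (γ ⊖ x))))
    (DC-const ℚ.≤-refl)

  -- The hypothesis keeps positive every vertex count that depends on the last increment (inv 0 = 0).
  shiftedCount-convex-last : ∀ m vK s cs γ → 1 ≤ s + sum cs →
    DecreasingConvex (shiftedCount vK s (cs ∷ʳ 0) γ m) (shiftedCount vK s (cs ∷ʳ 1) γ m)
                     (shiftedCount vK s (cs ∷ʳ 2) γ m)
  pendingStep-convex-last : ∀ m vK s cs γ → 1 ≤ s + sum cs →
    DecreasingConvex (pendingStep vK s (cs ∷ʳ 0) γ m) (pendingStep vK s (cs ∷ʳ 1) γ m)
                     (pendingStep vK s (cs ∷ʳ 2) γ m)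

  shiftedCount-convex-last zero    vK s []      γ _ = DC-const ℚ.≤-refl
  shiftedCount-convex-last zero    vK s (_ ∷ _) γ _ = DC-const ℚ.≤-refl
  shiftedCount-convex-last (suc m) vK s cs      γ 1≤s+Σcs = DC-+
    (DC-sum (edges n) λ x → DC-whenPos (γ x) (DC-*ˡ (0≤inv (length (insertEdge x vK) + s))
      (shiftedCount-convex-last m (insertEdge x vK) s cs (γ ⊖ x) 1≤s+Σcs)))
    (pendingStep-convex-last m vK s cs γ 1≤s+Σcs)

  pendingStep-convex-last m vK (suc t) []       γ _ = DC-* (DC-inv (length vK) t) (shiftedCount-convex-shift m vK t γ)
  pendingStep-convex-last m vK s       (c ∷ cs) γ 1≤s+Σcs = DC-*ˡ (0≤inv (length vK + (c + s)))
    (shiftedCount-convex-last m vK (c + s) cs γ (subst (1 ≤_) s+[c+Σcs]≡[c+s]+Σcs 1≤s+Σcs))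
    where
    s+[c+Σcs]≡[c+s]+Σcs : s + (c + sum cs) ≡ (c + s) + sum cs
    s+[c+Σcs]≡[c+s]+Σcs = trans (sym (ℕ.+-assoc s c (sum cs))) (cong (_+ sum cs) (ℕ.+-comm s c))

-- Edges inside [k] and extra edges above k

module ExtraEdges (k n : ℕ) where

  KEdge : Edge → Set
  KEdge (a , c) = a ≤ k × c ≤ k

  ExtraEdge : Edge → Set
  ExtraEdge (p , q) = k < p × p < q × q ≤ n

  SupportedOnK : (Edge → ℕ) → Set
  SupportedOnK γ = ∀ x j → γ x ≡ suc j → KEdge x

  Shifted : List ℕ → List ℕ → ℕ → Set
  Shifted vs vK s = (∀ y → y ≤ k → y ∈ᵇ vs ≡ y ∈ᵇ vK) × length vs ≡ length vK + s

  AgreeAbove : List ℕ → List ℕ → Set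
  AgreeAbove ws ws′ = ∀ y → k < y → y ∈ᵇ ws ≡ y ∈ᵇ ws′

  private
    below≢above : ∀ {y z} → y ≤ k → k < z → y ≢ z
    below≢above y≤k k<z refl = ℕ.<⇒≱ k<z y≤k

    above≢below : ∀ {y z} → k < y → z ≤ k → y ≢ z
    above≢below k<y z≤k = below≢above z≤k k<y ∘ sym

  ∈-edges-extra : ∀ {h} → ExtraEdge h → h ∈ edges n
  ∈-edges-extra (k<p , p<q , q≤n) = ∈-edges (ℕ.<-≤-trans (s≤s z≤n) k<p) p<q q≤n

  SupportedOnK-⊖ : ∀ {γ} x → SupportedOnK γ → SupportedOnK (γ ⊖ x)
  SupportedOnK-⊖ {γ} x supp y j eq with γ y in γy
  ... | suc i = supp y i γy
  ... | zero with () ← trans (sym (ℕ.0∸n≡0 (v x y))) eq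

  SupportedOnK-extra : ∀ {γ h} → SupportedOnK γ → ExtraEdge h → γ h ≡ 0
  SupportedOnK-extra {γ} {p , q} supp (k<p , _) with γ (p , q) in γh
  ... | zero  = refl
  ... | suc j = ⊥-elim (ℕ.<⇒≱ k<p (proj₁ (supp (p , q) j γh)))

  AgreeAbove-insertKEdge : ∀ {x} ws → KEdge x → AgreeAbove (insertEdge x ws) ws
  AgreeAbove-insertKEdge {a , c} ws (a≤k , c≤k) y k<y =
    trans (∈ᵇ-insertV-≢ (insertV a ws) (above≢below k<y c≤k)) (∈ᵇ-insertV-≢ ws (above≢below k<y a≤k))

  ∈ᵇ-insertExtraEdge : ∀ {h y} ws → ExtraEdge h → y ≤ k → y ∈ᵇ insertEdge h ws ≡ y ∈ᵇ ws
  ∈ᵇ-insertExtraEdge {p , q} ws (k<p , p<q , _) y≤k =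
    trans (∈ᵇ-insertV-≢ (insertV p ws) (below≢above y≤k (ℕ.<-trans k<p p<q))) (∈ᵇ-insertV-≢ ws (below≢above y≤k k<p))

  AgreeAbove-insertEdge : ∀ h {ws ws′} → AgreeAbove ws ws′ → AgreeAbove (insertEdge h ws) (insertEdge h ws′)
  AgreeAbove-insertEdge (p , q) {ws} {ws′} agree y k<y =
    trans (∈ᵇ-insertEdge y (p , q) ws)
      (trans (cong (λ b → does (y ℕ.≟ q) ∨ (does (y ℕ.≟ p) ∨ b)) (agree y k<y)) (sym (∈ᵇ-insertEdge y (p , q) ws′)))

  AgreeAbove-trans : ∀ {ws ws′ ws″} → AgreeAbove ws ws′ → AgreeAbove ws′ ws″ → AgreeAbove ws ws″
  AgreeAbove-trans agree agree′ y k<y = trans (agree y k<y) (agree′ y k<y)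

  newVertices-cong : ∀ h ws ws′ → ExtraEdge h → AgreeAbove ws ws′ → newVertices h ws ≡ newVertices h ws′
  newVertices-cong (p , q) ws ws′ (k<p , p<q , _) agree =
    cong₂ _+_ (cong (if_then 0 else 1) (agree p k<p)) (cong (if_then 0 else 1) (agree q (ℕ.<-trans k<p p<q)))

  Shifted-refl : ∀ vs → Shifted vs vs 0
  Shifted-refl vs = (λ _ _ → refl) , sym (ℕ.+-identityʳ (length vs))

  Shifted-insertV : ∀ {a vs vK s} → a ≤ k → Shifted vs vK s → Shifted (insertV a vs) (insertV a vK) s
  Shifted-insertV {a} {vs} {vK} {s} a≤k (agree , len) = agree′ , len′
    where
    agree′ : ∀ y → y ≤ k → y ∈ᵇ insertV a vs ≡ y ∈ᵇ insertV a vK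
    agree′ y y≤k = trans (∈ᵇ-insertV y a vs)
      (trans (cong (does (y ℕ.≟ a) ∨_) (agree y y≤k)) (sym (∈ᵇ-insertV y a vK)))
    len′ : length (insertV a vs) ≡ length (insertV a vK) + s
    len′ rewrite length-insertV a vs | length-insertV a vK | agree a a≤k with a ∈ᵇ vK
    ... | true  = len
    ... | false = cong suc len

  Shifted-insertKEdge : ∀ {x vs vK s} → KEdge x → Shifted vs vK s → Shifted (insertEdge x vs) (insertEdge x vK) s
  Shifted-insertKEdge {a , c} {vs} {vK} (a≤k , c≤k) sh =
    Shifted-insertV {vs = insertV a vs} {insertV a vK} c≤k (Shifted-insertV {vs = vs} {vK} a≤k sh)

  Shifted-insertExtraEdge : ∀ {h vs vK s c} → ExtraEdge h → Shifted vs vK s → newVertices h vs ≡ c →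
                            Shifted (insertEdge h vs) vK (c + s)
  Shifted-insertExtraEdge {p , q} {vs} {vK} {s} {c} X@(k<p , p<q , _) (agree , len) new≡c =
    (λ y y≤k → trans (∈ᵇ-insertExtraEdge vs X y≤k) (agree y y≤k)) , (begin
      length (insertEdge (p , q) vs)    ≡⟨ length-insertEdge vs (ℕ.>⇒≢ p<q) ⟩
      length vs + newVertices (p , q) vs ≡⟨ cong₂ _+_ len new≡c ⟩
      (length vK + s) + c               ≡⟨ ℕ.+-assoc (length vK) s c ⟩
      length vK + (s + c)               ≡⟨ cong (λ z → length vK + z) (ℕ.+-comm s c) ⟩
      length vK + (c + s)               ∎)
    where open ≡-Reasoning

  firstStep-KEdge : ∀ {vs vK s α γ m R} x → α x ≡ γ x → SupportedOnK γ →
    (KEdge x → countFrom n (insertEdge x vs) (α ⊖ x) m ≡ R) → Shifted vs vK s →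
    firstStep n vs α m x ≡ whenPos (γ x) (inv (length (insertEdge x vK) + s) * R)
  firstStep-KEdge {vs} {vK} x αx≡γx supp rec sh = whenPos-cong αx≡γx λ j γx≡1+j →
    let KEx = supp x j γx≡1+j in
    cong₂ _*_ (cong inv (proj₂ (Shifted-insertKEdge {x} {vs} {vK} KEx sh))) (rec KEx)

  firstStep-extra : ∀ {vs vK s c α m j R} h → ExtraEdge h → α h ≡ suc j →
    Shifted vs vK s → newVertices h vs ≡ c → countFrom n (insertEdge h vs) (α ⊖ h) m ≡ R →
    firstStep n vs α m h ≡ inv (length vK + (c + s)) * R
  firstStep-extra {vs} {vK} h X αh≡1+j sh new≡c rec = whenPos-cong αh≡1+j λ _ _ →
    cong₂ _*_ (cong inv (proj₂ (Shifted-insertExtraEdge {h} {vs} {vK} X sh new≡c))) rec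

  shiftedStep-extra : ∀ {vK s cs γ m h} → SupportedOnK γ → ExtraEdge h → shiftedStep n vK s cs γ m h ≡ 0ℚ
  shiftedStep-extra {vK} {s} {cs} {γ} {m} {h} supp X =
    whenPos-cong {r = 0ℚ} (SupportedOnK-extra {γ} {h} supp X) λ _ ()

  sumℚ-edges-with-extra : ∀ {f g : Edge → ℚ} {h A} → ExtraEdge h →
    (∀ x → x ≢ h → f x ≡ g x) → g h ≡ 0ℚ → f h ≡ A →
    sumℚ (map f (edges n)) ≡ sumℚ (map g (edges n)) +ℚ A
  sumℚ-edges-with-extra {f} {g} {h@(p , q)} {A} (k<p , p<q , q≤n) off gh≡0 fh≡A = begin
    sumℚ (map f (edges n))                              ≡⟨ sumℚ-cong (edges n) (λ {x} _ → split x) ⟩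
    sumℚ (map (λ x → g x +ℚ δ h A x) (edges n))         ≡⟨ sumℚ-+ g (δ h A) (edges n) ⟩
    sumℚ (map g (edges n)) +ℚ sumℚ (map (δ h A) (edges n))
      ≡⟨ cong (sumℚ (map g (edges n)) +ℚ_) (sumℚ-edges-δ (ℕ.<-≤-trans (s≤s z≤n) k<p) p<q q≤n A) ⟩
    sumℚ (map g (edges n)) +ℚ A                         ∎
    where
    open ≡-Reasoning
    split : ∀ x → f x ≡ g x +ℚ δ h A x
    split x = [ (λ { refl → trans fh≡A (sym (trans (cong₂ _+ℚ_ gh≡0 (δ-self h A)) (ℚ.+-identityˡ A))) })
              , (λ x≢h → trans (off x x≢h) (sym (trans (cong (g x +ℚ_) (δ-≢ h A x x≢h)) (ℚ.+-identityʳ (g x))))) ]′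
              (toSum (x ≟E h))

  ⊖-cong : ∀ {α β} x → α ≗ β → α ⊖ x ≗ β ⊖ x
  ⊖-cong x α≗β y = cong (_∸ v x y) (α≗β y)

  countFrom≡shiftedCount-noExtra : ∀ m {vs vK s α γ} → α ≗ γ → SupportedOnK γ → Shifted vs vK s →
    countFrom n vs α m ≡ shiftedCount n vK s [] γ m
  countFrom≡shiftedCount-noExtra zero {vs} {α = α} α≗γ supp sh =
    trans (countFrom-zero n vs α) (cong (if_then 1ℚ else 0ℚ) (matches-cong n [] α≗γ))
  countFrom≡shiftedCount-noExtra (suc m) {vs} {vK} {s} {α} {γ} α≗γ supp sh = begin
    countFrom n vs α (suc m)                           ≡⟨ countFrom-suc n vs α m ⟩
    sumℚ (map (firstStep n vs α m) (edges n))          ≡⟨ sumℚ-cong (edges n) (λ {x} _ → step x) ⟩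
    sumℚ (map (shiftedStep n vK s [] γ m) (edges n))   ≡⟨ ℚ.+-identityʳ _ ⟨
    shiftedCount n vK s [] γ (suc m)                   ∎
    where
    open ≡-Reasoning
    step : ∀ x → firstStep n vs α m x ≡ shiftedStep n vK s [] γ m x
    step x = firstStep-KEdge {vs} {vK} {s} {α} {γ} {m} x (α≗γ x) supp
      (λ KEx → countFrom≡shiftedCount-noExtra m (⊖-cong x α≗γ) (SupportedOnK-⊖ x supp)
                 (Shifted-insertKEdge {x} {vs} {vK} KEx sh)) sh

  ≗⊕-off : ∀ {α γ β : Edge → ℕ} {x} → α ≗ γ ⊕ β → β x ≡ 0 → α x ≡ γ x
  ≗⊕-off {α} {γ} {β} {x} α≗γ⊕β βx≡0 = trans (α≗γ⊕β x) (trans (cong (λ z → γ x + z) βx≡0) (ℕ.+-identityʳ (γ x)))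

  ≗⊕-extra : ∀ {α γ β β′ : Edge → ℕ} {h} → α ≗ γ ⊕ β → (∀ y → β y ≡ v h y + β′ y) → SupportedOnK γ → ExtraEdge h →
             α h ≡ suc (β′ h)
  ≗⊕-extra {α} {γ} {β} {β′} {h} α≗γ⊕β β≗vh+β′ supp X =
    trans (α≗γ⊕β h) (cong₂ _+_ (SupportedOnK-extra {γ} {h} supp X) (trans (β≗vh+β′ h) (cong (_+ β′ h) (v-self h))))

  ⊖-KEdge : ∀ {α γ β : Edge → ℕ} x → α ≗ γ ⊕ β → β x ≡ 0 → α ⊖ x ≗ (γ ⊖ x) ⊕ β
  ⊖-KEdge {α} {γ} {β} x α≗γ⊕β βx≡0 y with y ≟E x
  ... | yes refl rewrite α≗γ⊕β y | βx≡0 = trans (cong (_∸ v y y) (ℕ.+-identityʳ (γ y))) (sym (ℕ.+-identityʳ _))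
  ... | no  y≢x  rewrite α≗γ⊕β y | v-≢ (y≢x ∘ sym) = refl

  ⊖-extra : ∀ {α γ β β′ : Edge → ℕ} h → α ≗ γ ⊕ β → (∀ y → β y ≡ v h y + β′ y) → α ⊖ h ≗ γ ⊕ β′
  ⊖-extra {α} {γ} {β} {β′} h α≗γ⊕β β≗vh+β′ y = begin
    α y ∸ v h y                    ≡⟨ cong (_∸ v h y) (trans (α≗γ⊕β y) (cong (λ z → γ y + z) (β≗vh+β′ y))) ⟩
    (γ y + (v h y + β′ y)) ∸ v h y  ≡⟨ ℕ.+-∸-assoc (γ y) (ℕ.m≤m+n (v h y) (β′ y)) ⟩
    γ y + ((v h y + β′ y) ∸ v h y)  ≡⟨ cong (λ z → γ y + z) (ℕ.m+n∸m≡n (v h y) (β′ y)) ⟩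
    γ y + β′ y                     ∎
    where open ≡-Reasoning

  countFrom≡shiftedCount-oneExtra : ∀ m {vs vK s c h} {α γ : Edge → ℕ} → α ≗ γ ⊕ v h → SupportedOnK γ →
    ExtraEdge h → Shifted vs vK s → newVertices h vs ≡ c →
    countFrom n vs α m ≡ shiftedCount n vK s (c ∷ []) γ m
  countFrom≡shiftedCount-oneExtra zero {vs} {h = h} {α} α≗γ⊕vh supp X sh new≡c =
    trans (countFrom-zero n vs α)
      (cong (if_then 1ℚ else 0ℚ) (matches-[]-false n {α} {h} αh≡1 (∈-edges-extra X)))
    where
    αh≡1 : α h ≡ 1
    αh≡1 = ≗⊕-extra α≗γ⊕vh (λ y → sym (ℕ.+-identityʳ (v h y))) supp X
  countFrom≡shiftedCount-oneExtra (suc m) {vs} {vK} {s} {c} {h} {α} {γ} α≗γ⊕vh supp X sh new≡c = begin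
    countFrom n vs α (suc m)                                 ≡⟨ countFrom-suc n vs α m ⟩
    sumℚ (map (firstStep n vs α m) (edges n))
      ≡⟨ sumℚ-edges-with-extra X kStep (shiftedStep-extra {vK} {s} {c ∷ []} {γ} {m} supp X) extraStep ⟩
    sumℚ (map (shiftedStep n vK s (c ∷ []) γ m) (edges n)) +ℚ pendingStep n vK s (c ∷ []) γ m ∎
    where
    open ≡-Reasoning
    kStep : ∀ x → x ≢ h → firstStep n vs α m x ≡ shiftedStep n vK s (c ∷ []) γ m x
    kStep x x≢h = firstStep-KEdge {vs} {vK} {s} {α} {γ} {m} x (≗⊕-off {α} {γ} {v h} α≗γ⊕vh vhx≡0) supp
      (λ KEx → countFrom≡shiftedCount-oneExtra m (⊖-KEdge x α≗γ⊕vh vhx≡0) (SupportedOnK-⊖ x supp) X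
                 (Shifted-insertKEdge {x} {vs} {vK} KEx sh)
                 (trans (newVertices-cong h (insertEdge x vs) vs X (AgreeAbove-insertKEdge vs KEx)) new≡c)) sh
      where
      vhx≡0 : v h x ≡ 0
      vhx≡0 = v-≢ (x≢h ∘ sym)
    extraStep : firstStep n vs α m h ≡ pendingStep n vK s (c ∷ []) γ m
    extraStep = firstStep-extra {vs} {vK} {s} {c} {α} {m} h X
      (≗⊕-extra α≗γ⊕vh (λ y → sym (ℕ.+-identityʳ (v h y))) supp X) sh new≡c
      (countFrom≡shiftedCount-noExtra m
        (λ y → trans (⊖-extra h α≗γ⊕vh (λ y → sym (ℕ.+-identityʳ (v h y))) y) (ℕ.+-identityʳ (γ y)))
        supp (Shifted-insertExtraEdge {h} {vs} {vK} X sh new≡c))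

  firstStep-firstOfTwoExtras : ∀ m {vs vK s c h h′} {α γ β : Edge → ℕ} → α ≗ γ ⊕ β →
    (∀ y → β y ≡ v h y + v h′ y) → SupportedOnK γ → ExtraEdge h → ExtraEdge h′ → Shifted vs vK s →
    AgreeAbove vs [] → newVertices h′ (insertEdge h []) ≡ c →
    firstStep n vs α m h ≡ pendingStep n vK s (2 ∷ c ∷ []) γ m
  firstStep-firstOfTwoExtras m {vs} {vK} {s} {c} {h} {h′} {α} {γ} {β} α≗γ⊕β β≗vh+vh′ supp X X′ sh noExtra new′≡c =
    firstStep-extra {vs} {vK} {s} {2} {α} {m} h X (≗⊕-extra α≗γ⊕β β≗vh+vh′ supp X) sh new≡2
      (countFrom≡shiftedCount-oneExtra m (⊖-extra {α} {γ} {β} {v h′} h α≗γ⊕β β≗vh+vh′) supp X′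
        (Shifted-insertExtraEdge {h} {vs} {vK} X sh new≡2)
        (trans (newVertices-cong h′ (insertEdge h vs) (insertEdge h []) X′ (AgreeAbove-insertEdge h {vs} {[]} noExtra))
               new′≡c))
    where
    new≡2 : newVertices h vs ≡ 2
    new≡2 = newVertices-cong h vs [] X noExtra

  countFrom≡shiftedCount-doubleExtra : ∀ m {vs vK s h} {α γ : Edge → ℕ} → α ≗ γ ⊕ (v h ⊕ v h) →
    SupportedOnK γ → ExtraEdge h → Shifted vs vK s → AgreeAbove vs [] →
    countFrom n vs α m ≡ shiftedCount n vK s (2 ∷ 0 ∷ []) γ m
  countFrom≡shiftedCount-doubleExtra zero {vs} {h = h} {α} α≗γ⊕2vh supp X sh noExtra =
    trans (countFrom-zero n vs α)
      (cong (if_then 1ℚ else 0ℚ) (matches-[]-false n {α} {h} (≗⊕-extra α≗γ⊕2vh (λ _ → refl) supp X) (∈-edges-extra X)))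
  countFrom≡shiftedCount-doubleExtra (suc m) {vs} {vK} {s} {h} {α} {γ} α≗γ⊕2vh supp X sh noExtra = begin
    countFrom n vs α (suc m)                                 ≡⟨ countFrom-suc n vs α m ⟩
    sumℚ (map (firstStep n vs α m) (edges n))
      ≡⟨ sumℚ-edges-with-extra X kStep (shiftedStep-extra {vK} {s} {2 ∷ 0 ∷ []} {γ} {m} supp X)
           (firstStep-firstOfTwoExtras m {vs} {vK} {s} {0} {h} {h} {α} {γ} {v h ⊕ v h} α≗γ⊕2vh (λ _ → refl)
              supp X X sh noExtra (newVertices-insertEdge-self h [])) ⟩
    sumℚ (map (shiftedStep n vK s (2 ∷ 0 ∷ []) γ m) (edges n)) +ℚ pendingStep n vK s (2 ∷ 0 ∷ []) γ m ∎
    where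
    open ≡-Reasoning
    kStep : ∀ x → x ≢ h → firstStep n vs α m x ≡ shiftedStep n vK s (2 ∷ 0 ∷ []) γ m x
    kStep x x≢h = firstStep-KEdge {vs} {vK} {s} {α} {γ} {m} x (≗⊕-off {α} {γ} {v h ⊕ v h} α≗γ⊕2vh 2vhx≡0) supp
      (λ KEx → countFrom≡shiftedCount-doubleExtra m (⊖-KEdge x α≗γ⊕2vh 2vhx≡0) (SupportedOnK-⊖ x supp) X
                 (Shifted-insertKEdge {x} {vs} {vK} KEx sh)
                 (AgreeAbove-trans {insertEdge x vs} {vs} {[]} (AgreeAbove-insertKEdge vs KEx) noExtra)) sh
      where
      2vhx≡0 : v h x + v h x ≡ 0
      2vhx≡0 = cong₂ _+_ (v-≢ (x≢h ∘ sym)) (v-≢ (x≢h ∘ sym))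

  sumℚ-edges-with-two-extras : ∀ {f g : Edge → ℚ} {h₁ h₂ A} → ExtraEdge h₁ → ExtraEdge h₂ → h₁ ≢ h₂ →
    (∀ x → x ≢ h₁ → x ≢ h₂ → f x ≡ g x +ℚ g x) → g h₁ ≡ 0ℚ → g h₂ ≡ 0ℚ → f h₁ ≡ A → f h₂ ≡ A →
    sumℚ (map f (edges n)) ≡ (sumℚ (map g (edges n)) +ℚ A) +ℚ (sumℚ (map g (edges n)) +ℚ A)
  sumℚ-edges-with-two-extras {f} {g} {h₁} {h₂} {A} X₁ X₂ h₁≢h₂ off gh₁≡0 gh₂≡0 fh₁≡A fh₂≡A = begin
    sumℚ (map f (edges n))                                   ≡⟨ sumℚ-cong (edges n) (λ {x} _ → split x) ⟩
    sumℚ (map (λ x → g₁ x +ℚ g₂ x) (edges n))                ≡⟨ sumℚ-+ g₁ g₂ (edges n) ⟩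
    sumℚ (map g₁ (edges n)) +ℚ sumℚ (map g₂ (edges n))
      ≡⟨ cong₂ _+ℚ_ (sumℚ-edges-with-extra X₁ (λ x x≢h₁ → g₁-off x x≢h₁) gh₁≡0 (g₁-at)) 
                    (sumℚ-edges-with-extra X₂ (λ x x≢h₂ → g₂-off x x≢h₂) gh₂≡0 (g₂-at)) ⟩
    (sumℚ (map g (edges n)) +ℚ A) +ℚ (sumℚ (map g (edges n)) +ℚ A) ∎
    where
    open ≡-Reasoning
    g₁ g₂ : Edge → ℚ
    g₁ x = g x +ℚ δ h₁ A x
    g₂ x = g x +ℚ δ h₂ A x
    g₁-off : ∀ x → x ≢ h₁ → g₁ x ≡ g x
    g₁-off x x≢h₁ = trans (cong (g x +ℚ_) (δ-≢ h₁ A x x≢h₁)) (ℚ.+-identityʳ (g x))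
    g₂-off : ∀ x → x ≢ h₂ → g₂ x ≡ g x
    g₂-off x x≢h₂ = trans (cong (g x +ℚ_) (δ-≢ h₂ A x x≢h₂)) (ℚ.+-identityʳ (g x))
    g₁-at : g₁ h₁ ≡ A
    g₁-at = trans (cong₂ _+ℚ_ gh₁≡0 (δ-self h₁ A)) (ℚ.+-identityˡ A)
    g₂-at : g₂ h₂ ≡ A
    g₂-at = trans (cong₂ _+ℚ_ gh₂≡0 (δ-self h₂ A)) (ℚ.+-identityˡ A)
    split : ∀ x → f x ≡ g₁ x +ℚ g₂ x
    split x = [ (λ { refl → at-h₁ }) , (λ x≢h₁ → [ (λ { refl → at-h₂ x≢h₁ }) , off-both x≢h₁ ]′ (toSum (x ≟E h₂))) ]′
              (toSum (x ≟E h₁))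
      where
      at-h₁ : f h₁ ≡ g₁ h₁ +ℚ g₂ h₁
      at-h₁ = trans fh₁≡A (sym (trans (cong₂ _+ℚ_ g₁-at (g₂-off h₁ h₁≢h₂))
                                       (trans (cong (A +ℚ_) gh₁≡0) (ℚ.+-identityʳ A))))
      at-h₂ : h₂ ≢ h₁ → f h₂ ≡ g₁ h₂ +ℚ g₂ h₂
      at-h₂ h₂≢h₁ = trans fh₂≡A (sym (trans (cong₂ _+ℚ_ (g₁-off h₂ h₂≢h₁) g₂-at)
                                            (trans (cong (_+ℚ A) gh₂≡0) (ℚ.+-identityˡ A))))
      off-both : x ≢ h₁ → x ≢ h₂ → f x ≡ g₁ x +ℚ g₂ x
      off-both x≢h₁ x≢h₂ = trans (off x x≢h₁ x≢h₂) (sym (cong₂ _+ℚ_ (g₁-off x x≢h₁) (g₂-off x x≢h₂)))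

  countFrom≡shiftedCount-twoExtras : ∀ m {vs vK s c h₁ h₂} {α γ : Edge → ℕ} → h₁ ≢ h₂ →
    α ≗ γ ⊕ (v h₁ ⊕ v h₂) → SupportedOnK γ → ExtraEdge h₁ → ExtraEdge h₂ → Shifted vs vK s → AgreeAbove vs [] →
    newVertices h₂ (insertEdge h₁ []) ≡ c → newVertices h₁ (insertEdge h₂ []) ≡ c →
    countFrom n vs α m ≡ shiftedCount n vK s (2 ∷ c ∷ []) γ m +ℚ shiftedCount n vK s (2 ∷ c ∷ []) γ m
  countFrom≡shiftedCount-twoExtras zero {vs} {h₁ = h₁} {α = α} _ α≗γ⊕vh₁⊕vh₂ supp X₁ _ _ _ _ _ =
    trans (countFrom-zero n vs α)
      (trans (cong (if_then 1ℚ else 0ℚ)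
               (matches-[]-false n {α} {h₁} (≗⊕-extra α≗γ⊕vh₁⊕vh₂ (λ _ → refl) supp X₁) (∈-edges-extra X₁)))
             (sym (ℚ.+-identityʳ 0ℚ)))
  countFrom≡shiftedCount-twoExtras (suc m) {vs} {vK} {s} {c} {h₁} {h₂} {α} {γ}
    h₁≢h₂ α≗γ⊕vh₁⊕vh₂ supp X₁ X₂ sh noExtra new₂≡c new₁≡c = begin
    countFrom n vs α (suc m)                            ≡⟨ countFrom-suc n vs α m ⟩
    sumℚ (map (firstStep n vs α m) (edges n))
      ≡⟨ sumℚ-edges-with-two-extras X₁ X₂ h₁≢h₂ kStep
           (shiftedStep-extra {vK} {s} {cs} {γ} {m} supp X₁) (shiftedStep-extra {vK} {s} {cs} {γ} {m} supp X₂)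
           (firstStep-firstOfTwoExtras m {vs} {vK} {s} {c} {h₁} {h₂} {α} {γ} {β} α≗γ⊕vh₁⊕vh₂ (λ _ → refl)
              supp X₁ X₂ sh noExtra new₂≡c)
           (firstStep-firstOfTwoExtras m {vs} {vK} {s} {c} {h₂} {h₁} {α} {γ} {β} α≗γ⊕vh₁⊕vh₂
              (λ y → ℕ.+-comm (v h₁ y) (v h₂ y)) supp X₂ X₁ sh noExtra new₁≡c) ⟩
    (sumℚ (map (shiftedStep n vK s cs γ m) (edges n)) +ℚ pendingStep n vK s cs γ m)
      +ℚ (sumℚ (map (shiftedStep n vK s cs γ m) (edges n)) +ℚ pendingStep n vK s cs γ m) ∎
    where
    open ≡-Reasoning
    cs = 2 ∷ c ∷ []
    β : Edge → ℕ
    β = v h₁ ⊕ v h₂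
    kStep : ∀ x → x ≢ h₁ → x ≢ h₂ → firstStep n vs α m x ≡ shiftedStep n vK s cs γ m x +ℚ shiftedStep n vK s cs γ m x
    kStep x x≢h₁ x≢h₂ =
      trans (firstStep-KEdge {vs} {vK} {s} {α} {γ} {m} x (≗⊕-off {α} {γ} {β} α≗γ⊕vh₁⊕vh₂ βx≡0) supp
               (λ KEx → countFrom≡shiftedCount-twoExtras m h₁≢h₂ (⊖-KEdge x α≗γ⊕vh₁⊕vh₂ βx≡0) (SupportedOnK-⊖ x supp)
                          X₁ X₂ (Shifted-insertKEdge {x} {vs} {vK} KEx sh)
                          (AgreeAbove-trans {insertEdge x vs} {vs} {[]} (AgreeAbove-insertKEdge vs KEx) noExtra)
                          new₂≡c new₁≡c) sh)
            (whenPos-*-distribˡ-+ (γ x) (inv (length (insertEdge x vK) + s)) _ _)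
      where
      βx≡0 : β x ≡ 0
      βx≡0 = cong₂ _+_ (v-≢ (x≢h₁ ∘ sym)) (v-≢ (x≢h₂ ∘ sym))

  Q-extra-diag : ∀ d {γ h} → SupportedOnK γ → ExtraEdge h →
    Q n d γ h h ≡ ℕtoℚ 2 * shiftedCount n [] 0 (2 ∷ 0 ∷ []) γ d
  Q-extra-diag d {γ} {h} supp X rewrite ==E-refl h | SupportedOnK-extra {γ} {h} supp X =
    cong (ℕtoℚ 2 *_) (countFrom≡shiftedCount-doubleExtra d (λ _ → refl) supp X (Shifted-refl []) (λ _ _ → refl))

  Q-extra-offdiag : ∀ d {γ h₁ h₂ c} → h₁ ≢ h₂ → SupportedOnK γ → ExtraEdge h₁ → ExtraEdge h₂ →
    newVertices h₂ (insertEdge h₁ []) ≡ c → newVertices h₁ (insertEdge h₂ []) ≡ c →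
    Q n d γ h₁ h₂ ≡ ℕtoℚ 1 * (shiftedCount n [] 0 (2 ∷ c ∷ []) γ d +ℚ shiftedCount n [] 0 (2 ∷ c ∷ []) γ d)
  Q-extra-offdiag d {γ} {h₁} {h₂} h₁≢h₂ supp X₁ X₂ new₂≡c new₁≡c
    rewrite ==E-≢ h₁≢h₂ | SupportedOnK-extra {γ} {h₁} supp X₁ | SupportedOnK-extra {γ} {h₂} supp X₂ =
    cong (ℕtoℚ 1 *_) (countFrom≡shiftedCount-twoExtras d h₁≢h₂ (λ _ → refl) supp X₁ X₂ (Shifted-refl []) (λ _ _ → refl)
                        new₂≡c new₁≡c)

module ThreeEntries (k : ℕ) where

  open ExtraEdges k (k + 4)

  e₁₂ e₁₃ e₃₄ : Edge
  e₁₂ = k + 1 , k + 2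
  e₁₃ = k + 1 , k + 3
  e₃₄ = k + 3 , k + 4

  private
    extra : ∀ {i j} → 0 < i → i < j → j ≤ 4 → ExtraEdge (k + i , k + j)
    extra 0<i i<j j≤4 = ℕ.m<m+n k 0<i , ℕ.+-monoʳ-< k i<j , ℕ.+-monoʳ-≤ k j≤4

  gammaOf-SupportedOnK : ∀ es → (∀ x → InUnion x es → 1 ≤ x × x ≤ k) → SupportedOnK (gammaOf es)
  gammaOf-SupportedOnK es bounded x j eq =
    let inA , inC = multiplicity-InUnion es x eq in proj₂ (bounded _ inA) , proj₂ (bounded _ inC)

  second-difference : ∀ d {γ} → SupportedOnK γ →
    let a = Q (k + 4) d γ
        S = λ c → shiftedCount (k + 4) [] 0 (2 ∷ c ∷ []) γ d
    in (a e₁₂ e₁₂ - ℕtoℚ 2 * a e₁₂ e₁₃) +ℚ a e₁₂ e₃₄ ≡ ℕtoℚ 2 * ((S 0 +ℚ S 2) - (S 1 +ℚ S 1))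
  second-difference d {γ} supp = trans
    (cong₂ _+ℚ_
      (cong₂ (λ p q → p - ℕtoℚ 2 * q)
        (Q-extra-diag d supp X₁₂)
        (Q-extra-offdiag d (shift-≢ (λ ())) supp X₁₂ X₁₃ (newVertices-+ˡ k 1 2 1 3) (newVertices-+ˡ k 1 3 1 2)))
      (Q-extra-offdiag d (shift-≢ (λ ())) supp X₁₂ X₃₄ (newVertices-+ˡ k 1 2 3 4) (newVertices-+ˡ k 3 4 1 2)))
    (solve 3 (λ x y z → (con (ℕtoℚ 2) :* x :- con (ℕtoℚ 2) :* (con (ℕtoℚ 1) :* (y :+ y))) :+ con (ℕtoℚ 1) :* (z :+ z)
                        := con (ℕtoℚ 2) :* ((x :+ z) :- (y :+ y))) refl (S 0) (S 1) (S 2))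
    where
    S : ℕ → ℚ
    S c = shiftedCount (k + 4) [] 0 (2 ∷ c ∷ []) γ d
    X₁₂ : ExtraEdge e₁₂
    X₁₂ = extra (s≤s z≤n) (s≤s (s≤s z≤n)) (s≤s (s≤s z≤n))
    X₁₃ : ExtraEdge e₁₃
    X₁₃ = extra (s≤s z≤n) (s≤s (s≤s z≤n)) (s≤s (s≤s (s≤s z≤n)))
    X₃₄ : ExtraEdge e₃₄
    X₃₄ = extra (s≤s z≤n) (s≤s (s≤s (s≤s (s≤s z≤n)))) (s≤s (s≤s (s≤s (s≤s z≤n))))
    shift-≢ : ∀ {a b a′ b′} → (a , b) ≢ (a′ , b′) → (k + a , k + b) ≢ (k + a′ , k + b′)
    shift-≢ {a} {b} {a′} {b′} ne eq =
      ne (cong₂ _,_ (ℕ.+-cancelˡ-≡ k a a′ (cong proj₁ eq)) (ℕ.+-cancelˡ-≡ k b b′ (cong proj₂ eq)))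

proposition1p6 : (d k : ℕ) → 2 ≤ d →
    (es : Vec Edge (d ∸ 2)) → All IsEdge es →
    (∀ x → (InUnion x (toList es) → 1 ≤ x × x ≤ k) × (1 ≤ x × x ≤ k → InUnion x (toList es))) →
    let a = Q (k + 4) d (gammaOf (toList es)) in
    0ℚ ≤ℚ (a (k + 1 , k + 2) (k + 1 , k + 2)
            - ℕtoℚ 2 * a (k + 1 , k + 2) (k + 1 , k + 3))
          +ℚ a (k + 1 , k + 2) (k + 3 , k + 4)
proposition1p6 d k _ es _ union≡[k] =
  0≤-≡ (second-difference d supported)
       (0≤* 0≤2 (convex (shiftedCount-convex-last (k + 4) d [] 0 (2 ∷ []) γ (s≤s z≤n))))
  where
  open ThreeEntries k
  γ : Edge → ℕ
  γ = gammaOf (toList es)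
  supported : ExtraEdges.SupportedOnK k (k + 4) γ
  supported = gammaOf-SupportedOnK (toList es) (proj₁ ∘ union≡[k])
  0≤2 : 0ℚ ≤ℚ ℕtoℚ 2
  0≤2 = ℚ.≤ᵇ⇒≤ _
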